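{- For every graph $G$ and every vertex $x$ of $G$, there exists an L-sequence of $G$ of maximum length (i.e., of length $\gamma_{gr}^{L}(G)$) that contains $x$.
   Context: For a vertex $v$, $N(v)$ is its open and $N[v]=N(v)\cup\{v\}$ its closed neighborhood. An L-sequence of $G$ is a sequence $(v_1,\ldots,v_k)$ of distinct vertices such that for each $i\in[k]$, $N[v_i]\setminus\bigcup_{j=1}^{i-1}N(v_j)\neq\emptyset$. $\gamma_{gr}^{L}(G)$ is the maximum length of an L-sequence of $G$. -}

module Defs where

open import Data.Nat using (ℕ; _≤_)
open import Data.Fin using (Fin)
open import Data.Bool using (Bool; true)
open import Data.List using (List; []; _∷_; _++_; [_]; length)
open import Data.List.Relation.Unary.All using (All)
open import Data.List.Relation.Unary.Unique.Propositional using (Unique)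
open import Data.Product using (Σ; ∃; _×_)
open import Data.Sum using (_⊎_)
open import Data.Unit using (⊤)
import Data.Empty
open import Relation.Nullary using (¬_)
open import Relation.Binary.PropositionalEquality using (_≡_)

record Graph : Set where
  field
    n      : ℕ
    adj    : Fin n → Fin n → Bool
    sym    : ∀ u v → adj u v ≡ adj v u
    irrefl : ∀ v → adj v v ≡ true → Data.Empty.⊥
open Graph public

module _ (G : Graph) where
  V : Set
  V = Fin (n G)

  InOpenN : V → V → Set
  InOpenN v u = adj G v u ≡ true

  InClosedN : V → V → Set
  InClosedN v u = (u ≡ v) ⊎ InOpenN v u

  Footprints : List V → V → Set
  Footprints prev v = Σ V λ u → InClosedN v u × All (λ w → ¬ InOpenN w u) prev

  LCond : List V → List V → Set
  LCond prev []       = ⊤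
  LCond prev (v ∷ vs) = Footprints prev v × LCond (prev ++ [ v ]) vs

  IsLSeq : List V → Set
  IsLSeq s = Unique s × LCond [] s

  IsMaxLSeq : List V → Set
  IsMaxLSeq s = IsLSeq s × (∀ t → IsLSeq t → length t ≤ length s)

{-# OPTIONS --safe #-}
module Submission where

open import Defs hiding (sym)
open import Data.Bool as Bool using (true)
open import Data.Empty using (⊥-elim)
open import Data.Fin as Fin using (Fin; zero; suc)
open import Data.Fin.Properties using (any?; pigeonhole)
open import Data.List using (List; []; _∷_; _++_; [_]; length; lookup)
open import Data.List.Membership.Propositional using (_∈_; _∉_)
open import Data.List.Membership.Propositional.Properties using (∈-lookup; ∈-++⁺ʳ)
open import Data.List.Properties using (length-++; ++-assoc; ++-identityʳ)
open import Data.List.Relation.Unary.All using (All; []; _∷_; all?)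
open import Data.List.Relation.Unary.All.Properties using (++⁺; ++⁻ˡ; ++⁻ʳ; ¬Any⇒All¬)
open import Data.List.Relation.Unary.Any using (here; there)
open import Data.List.Relation.Unary.Unique.Propositional using (Unique; []; _∷_)
import Data.List.Relation.Unary.Unique.Propositional.Properties as Unique
open import Data.Nat using (zero; suc; _≤_; _≤?_; z≤n; s≤s⁻¹)
open import Data.Nat.Properties using (≤-trans; ≤-reflexive; ≰⇒>; ≤∧≢⇒<; m<1+n⇒m≤n; m+1+n≰m)
open import Data.Product using (Σ; ∃; _×_; _,_; proj₁)
open import Data.Sum using (_⊎_; inj₁; inj₂)
open import Data.Unit using (tt)
open import Function using (_∘_)
open import Level using (0ℓ)
open import Relation.Binary.PropositionalEquality using (_≡_; _≢_; refl; trans; cong; subst; sym)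
open import Relation.Nullary using (¬_; Dec; yes; no; ¬?)
open import Relation.Nullary.Decidable using (_×-dec_; _⊎-dec_)
open import Relation.Unary using (Pred; Decidable; _⊆_)

-- A maximum L-sequence exists since L-sequences have at most |V| entries. Let s be one
-- avoiding x. Vertex x starts with footprint x; walk along s until the first entry v after
-- which x has no footprint left, so that N[x] is then dominated. Replacing v by x keeps an
-- L-sequence of the same length, because a vertex undominated by the entries up to v cannot
-- lie in N(x). If no such v exists, x still has a footprint after all of s and s followed by
-- x is a longer L-sequence, contradicting maximality.

module _ {A : Set} where

  Unique⇒lookup≢ : ∀ {xs : List A} → Unique xs →
                   ∀ {i j} → i Fin.< j → lookup xs i ≢ lookup xs j
  Unique⇒lookup≢ {x ∷ xs} xs! {zero} {suc j} _ eq =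
    Unique.Unique[x∷xs]⇒x∉xs xs! (subst (_∈ xs) (sym eq) (∈-lookup j))
  Unique⇒lookup≢ {x ∷ xs} (_ ∷ xs!) {suc i} {suc j} i<j =
    Unique⇒lookup≢ xs! (s≤s⁻¹ i<j)

  Unique-∷ʳ⁺ : ∀ {xs : List A} {x} → Unique xs → x ∉ xs → Unique (xs ++ [ x ])
  Unique-∷ʳ⁺ xs! x∉xs = Unique.++⁺ xs! ([] ∷ []) λ { (x∈xs , here refl) → x∉xs x∈xs }

  Unique-replace : ∀ ys {v x : A} {zs} → Unique (ys ++ v ∷ zs) →
                   x ∉ ys ++ v ∷ zs → Unique (ys ++ x ∷ zs)
  Unique-replace [] (_ ∷ zs!) x∉ = ¬Any⇒All¬ _ (x∉ ∘ there) ∷ zs!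
  Unique-replace (y ∷ ys) {v} {x} {zs} (y∉ ∷ rest!) x∉ =
    ++⁺ (++⁻ˡ ys y∉) (y≢x ∷ tail (++⁻ʳ ys y∉)) ∷ Unique-replace ys rest! (x∉ ∘ there)
    where
    y≢x : y ≢ x
    y≢x refl = x∉ (here refl)
    tail : All (y ≢_) (v ∷ zs) → All (y ≢_) zs
    tail (_ ∷ ps) = ps

  length-replace : ∀ ys (v x : A) zs → length (ys ++ x ∷ zs) ≡ length (ys ++ v ∷ zs)
  length-replace ys v x zs = trans (length-++ ys) (sym (length-++ ys))

Unique⇒length≤ : ∀ {m} {xs : List (Fin m)} → Unique xs → length xs ≤ m
Unique⇒length≤ {m} {xs} xs! with length xs ≤? m
... | yes ≤m = ≤m
... | no ≰m with i , j , i<j , eq ← pigeonhole (≰⇒> ≰m) (lookup xs) =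
  ⊥-elim (Unique⇒lookup≢ xs! i<j eq)

any-ofLength? : ∀ {m} k (P : Pred (List (Fin m)) 0ℓ) → Decidable P →
                Dec (∃ λ t → length t ≡ k × P t)
any-ofLength? zero P P? with P? []
... | yes p = yes ([] , refl , p)
... | no ¬p = no λ { ([] , _ , p) → ¬p p }
any-ofLength? (suc k) P P? with any? (λ v → any-ofLength? k (P ∘ (v ∷_)) (P? ∘ (v ∷_)))
... | yes (v , t , refl , p) = yes (v ∷ t , refl , p)
... | no ∄ = no λ { (v ∷ t , refl , p) → ∄ (v , t , refl , p) }

IsLongest : ∀ {m} → Pred (List (Fin m)) 0ℓ → Pred (List (Fin m)) 0ℓ
IsLongest P s = P s × (∀ t → P t → length t ≤ length s)

module _ {m} {P : Pred (List (Fin m)) 0ℓ} (P? : Decidable P) where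

  longest-upTo : ∀ {s₀} → P s₀ → ∀ N →
                 ∃ λ s → P s × (∀ t → P t → length t ≤ N → length t ≤ length s)
  longest-upTo p₀ zero = _ , p₀ , λ t _ |t|≤0 → ≤-trans |t|≤0 z≤n
  longest-upTo p₀ (suc N) with any-ofLength? (suc N) P P?
  ... | yes (s , |s|≡1+N , p) = s , p , λ t _ ≤1+N → ≤-trans ≤1+N (≤-reflexive (sym |s|≡1+N))
  ... | no ∄ with s , p , longer ← longest-upTo p₀ N = s , p , λ t pt ≤1+N →
    longer t pt (m<1+n⇒m≤n (≤∧≢⇒< ≤1+N λ |t|≡1+N → ∄ (t , |t|≡1+N , pt)))

  longest : ∀ {s₀} N → P s₀ → (∀ t → P t → length t ≤ N) → ∃ (IsLongest P)
  longest N p₀ bounded with s , p , longer ← longest-upTo p₀ N =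
    s , p , λ t pt → longer t pt (bounded t pt)

module _ (G : Graph) where

  InOpenN? : ∀ v u → Dec (InOpenN G v u)
  InOpenN? v u = adj G v u Bool.≟ true

  InClosedN? : ∀ v u → Dec (InClosedN G v u)
  InClosedN? v u = (u Fin.≟ v) ⊎-dec InOpenN? v u

  Undominated : List (V G) → Pred (V G) 0ℓ
  Undominated prev u = All (λ w → ¬ InOpenN G w u) prev

  Footprints? : ∀ prev v → Dec (Footprints G prev v)
  Footprints? prev v = any? λ u → InClosedN? v u ×-dec all? (λ w → ¬? (InOpenN? w u)) prev

  LCond? : ∀ prev s → Dec (LCond G prev s)
  LCond? prev []       = yes tt
  LCond? prev (v ∷ vs) = Footprints? prev v ×-dec LCond? (prev ++ [ v ]) vs

  IsLSeq? : Decidable (IsLSeq G)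
  IsLSeq? s = unique? s ×-dec LCond? [] s
    where open import Data.List.Relation.Unary.Unique.DecPropositional Fin._≟_ using (unique?)

  maxLSeq : ∃ (IsMaxLSeq G)
  maxLSeq = longest IsLSeq? (n G) ([] , tt) λ t → Unique⇒length≤ ∘ proj₁

  Undominated-++⁺ : ∀ {p p'} q → Undominated p ⊆ Undominated p' →
                    Undominated (p ++ q) ⊆ Undominated (p' ++ q)
  Undominated-++⁺ {p} q p⊆p' u∉N = ++⁺ (p⊆p' (++⁻ˡ p u∉N)) (++⁻ʳ p u∉N)

  LCond-mono : ∀ {p p'} s → Undominated p ⊆ Undominated p' → LCond G p s → LCond G p' s
  LCond-mono []       _     _ = tt
  LCond-mono (v ∷ vs) p⊆p' ((u , u∈N[v] , u∉N) , rest) =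
    (u , u∈N[v] , p⊆p' u∉N) , LCond-mono vs (Undominated-++⁺ [ v ] p⊆p') rest

  LCond-∷ʳ⁺ : ∀ {p} s x → LCond G p s → Footprints G (p ++ s) x → LCond G p (s ++ [ x ])
  LCond-∷ʳ⁺ {p} []       x _ fp =
    subst (λ q → Footprints G q x) (++-identityʳ p) fp , tt
  LCond-∷ʳ⁺ {p} (v ∷ vs) x (fp-v , rest) fp =
    fp-v , LCond-∷ʳ⁺ vs x rest (subst (λ q → Footprints G q x) (sym (++-assoc p [ v ] vs)) fp)

  record Swap (prev s : List (V G)) (x : V G) : Set where
    field
      before   : List (V G)
      replaced : V G
      after    : List (V G)
      split    : s ≡ before ++ replaced ∷ after
      lcond    : LCond G prev (before ++ x ∷ after)

  footprint-persists-or-swap : ∀ {prev} s x → LCond G prev s → Footprints G prev x →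
                               Footprints G (prev ++ s) x ⊎ Swap prev s x
  footprint-persists-or-swap {prev} [] x _ fp =
    inj₁ (subst (λ q → Footprints G q x) (sym (++-identityʳ prev)) fp)
  footprint-persists-or-swap {prev} (v ∷ vs) x (fp-v , rest) fp with Footprints? (prev ++ [ v ]) x
  ... | no ¬fp = inj₂ record
    { before = [] ; replaced = v ; after = vs ; split = refl
    ; lcond = fp , LCond-mono vs v⊆x rest }
    where
    v⊆x : Undominated (prev ++ [ v ]) ⊆ Undominated (prev ++ [ x ])
    v⊆x {u} u∉N = ++⁺ (++⁻ˡ prev u∉N) ((λ u∈N[x] → ¬fp (u , inj₂ u∈N[x] , u∉N)) ∷ [])
  ... | yes fp' with footprint-persists-or-swap vs x rest fp'
  ...   | inj₁ fp'' = inj₁ (subst (λ q → Footprints G q x) (++-assoc prev [ v ] vs) fp'')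
  ...   | inj₂ sw = inj₂ record
    { before = v ∷ before ; replaced = replaced ; after = after
    ; split = cong (v ∷_) split ; lcond = fp-v , lcond }
    where open Swap sw

  maxLSeq-through : ∀ {s} x → IsMaxLSeq G s → x ∉ s →
                    Σ (List (V G)) λ s' → IsMaxLSeq G s' × x ∈ s'
  maxLSeq-through {s} x ((s! , lc) , maximal) x∉s
    with footprint-persists-or-swap s x lc (x , inj₁ refl , [])
  ... | inj₁ fp = ⊥-elim (m+1+n≰m (length s) (subst (_≤ length s) (length-++ s) longer))
    where
    longer : length (s ++ [ x ]) ≤ length s
    longer = maximal (s ++ [ x ]) (Unique-∷ʳ⁺ s! x∉s , LCond-∷ʳ⁺ s x lc fp)
  ... | inj₂ record { before = a ; replaced = v ; after = b ; split = refl ; lcond = lc' } =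
    a ++ x ∷ b ,
    ((Unique-replace a s! x∉s , lc') ,
      λ t lt → subst (length t ≤_) (sym (length-replace a v x b)) (maximal t lt)) ,
    ∈-++⁺ʳ a (here refl)

proposition6p1 : (G : Graph) → (x : V G) →
    Σ (List (V G)) λ s → IsMaxLSeq G s × x ∈ s
proposition6p1 G x with s , max ← maxLSeq G with x ∈? s
  where open import Data.List.Membership.DecPropositional (Fin._≟_ {n G}) using (_∈?_)
... | yes x∈s = s , max , x∈s
... | no x∉s = maxLSeq-through G x max x∉s
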